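{- Let $n$ be even and let $P$ be an $n\times n$ permutation matrix. Then there exist $n\times n$ centrosymmetric permutation matrices $Q_1$ and $Q_2$ such that $P+P^{\pi}=Q_1+Q_2$.
   Context: For an $n\times n$ matrix $A=[a_{ij}]$, $A^{\pi}$ is the matrix whose $(i,j)$ entry is $a_{n+1-i,n+1-j}$; $A$ is centrosymmetric if $A^{\pi}=A$. -}

module Defs where

open import Data.Nat using (ℕ; zero; suc; _+_)
open import Data.Fin using (Fin; opposite)
open import Data.Product using (Σ; _×_; ∃)
open import Relation.Binary.PropositionalEquality using (_≡_)
open import Data.Sum using (_⊎_)

Matrix : ℕ → Set
Matrix n = Fin n → Fin n → ℕ

IsPermutationMatrix : {n : ℕ} → Matrix n → Set
IsPermutationMatrix {n} A =
  ((i j : Fin n) → (A i j ≡ 0) ⊎ (A i j ≡ 1))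
  × ((i : Fin n) → Σ (Fin n) λ j → (A i j ≡ 1) × ((j′ : Fin n) → A i j′ ≡ 1 → j′ ≡ j))
  × ((j : Fin n) → Σ (Fin n) λ i → (A i j ≡ 1) × ((i′ : Fin n) → A i′ j ≡ 1 → i′ ≡ i))

-- A^π : (i,j) entry is a_{n+1-i, n+1-j}; with 0-based indices this is
-- a_{n-1-i, n-1-j}, i.e. Data.Fin.opposite.
_^π : {n : ℕ} → Matrix n → Matrix n
(A ^π) i j = A (opposite i) (opposite j)

IsCentrosymmetric : {n : ℕ} → Matrix n → Set
IsCentrosymmetric {n} A = (i j : Fin n) → (A ^π) i j ≡ A i j

_⊕_ : {n : ℕ} → Matrix n → Matrix n → Matrix n
(A ⊕ B) i j = A i j + B i j

module Submission where

-- Write P as the matrix of a permutation σ; then P^π is the matrix of σ̃ = ω ∘ σ ∘ ω,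
-- where ω = opposite. Given c : Fin n → Bool, let τ₁ follow σ on the rows where c holds
-- and σ̃ elsewhere, and τ₂ the other way round; the matrices of τ₁ and τ₂ add up to
-- P + P^π. They are bijective as soon as c is constant along σ̃⁻¹ ∘ σ = ω ∘ β, where
-- β = σ⁻¹ ∘ ω ∘ σ, and centrosymmetric as soon as c ∘ ω = not ∘ c. As n is even, ω and β
-- are fixed-point-free involutions, and the required c is a proper 2-colouring of the
-- union of these two perfect matchings: x and ω x never lie in the same orbit of ω ∘ β,
-- and c x records whether the orbit of x has a smaller least element than that of ω x.

open import Algebra.Definitions using (Involutive)
open import Data.Bool using (Bool; true; false; not; if_then_else_)
open import Data.Bool.Properties using (not-involutive; if-cong)
open import Data.Fin using (Fin; toℕ; opposite; _≟_)
open import Data.Fin.Permutation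
  using (Permutation′; permutation; _⟨$⟩ʳ_; _⟨$⟩ˡ_; inverseˡ; inverseʳ; _∘ₚ_; reverse; _≈_)
open import Data.Fin.Properties
  using (toℕ-injective; toℕ<n; pigeonhole; opposite-prop; opposite-involutive)
open import Data.Nat using (ℕ; zero; suc; _+_; _*_; _∸_; _≤_; _<_; _⊓_; _<?_; _%_; _/_; z≤n; s≤s)
open import Data.Nat.Divisibility using (_∣_; divides)
open import Data.Nat.DivMod using (m≡m%n+[m/n]*n; m%n<n)
open import Data.Nat.Properties hiding (_≟_)
open import Data.Product using (Σ; _×_; _,_; proj₁; proj₂; ∃-syntax; ∃₂)
open import Data.Sum using (_⊎_; inj₁; inj₂)
open import Function using (_∘_)
open import Function.Definitions using (Injective)
import Function.Endo.Propositional as Endo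
open import Relation.Nullary using (Dec; yes; no; does; contradiction)
open import Relation.Binary.PropositionalEquality

open import Defs

involutive⇒injective : ∀ {A : Set} {f : A → A} → Involutive _≡_ f → Injective _≡_ _≡_ f
involutive⇒injective {f = f} f-involutive {x} {y} fx≡fy =
  trans (sym (f-involutive x)) (trans (cong f fx≡fy) (f-involutive y))

minUpTo : (ℕ → ℕ) → ℕ → ℕ
minUpTo g zero    = g zero
minUpTo g (suc m) = g (suc m) ⊓ minUpTo g m

minUpTo-≤ : ∀ g {m k} → k ≤ m → minUpTo g m ≤ g k
minUpTo-≤ g {zero}  z≤n = ≤-refl
minUpTo-≤ g {suc m} k≤1+m with m≤n⇒m<n∨m≡n k≤1+m
... | inj₂ refl    = m⊓n≤m _ _
... | inj₁ k<1+m   = ≤-trans (m⊓n≤n _ _) (minUpTo-≤ g (≤-pred k<1+m))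

minUpTo-attained : ∀ g m → ∃[ k ] minUpTo g m ≡ g k
minUpTo-attained g zero = zero , refl
minUpTo-attained g (suc m) with ⊓-sel (g (suc m)) (minUpTo g m)
... | inj₁ eq = suc m , eq
... | inj₂ eq = let k , eq′ = minUpTo-attained g m in k , trans eq eq′

module Orbits {n : ℕ} (f : Fin n → Fin n) (f-injective : Injective _≡_ _≡_ f) where

  open Endo (Fin n) using (_^_; ^-homo)

  ^-+ : ∀ j k x → (f ^ (j + k)) x ≡ (f ^ j) ((f ^ k) x)
  ^-+ j k = cong-app (^-homo f j k)

  ^-comm : ∀ k x → (f ^ k) (f x) ≡ f ((f ^ k) x)
  ^-comm zero    x = refl
  ^-comm (suc k) x = cong f (^-comm k x)

  ^-injective : ∀ k → Injective _≡_ _≡_ (f ^ k)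
  ^-injective zero    eq = eq
  ^-injective (suc k) eq = ^-injective k (f-injective eq)

  ^-*-fixed : ∀ {d x} q → (f ^ d) x ≡ x → (f ^ (q * d)) x ≡ x
  ^-*-fixed zero    _       = refl
  ^-*-fixed {d} {x} (suc q) fᵈx≡x = begin
    (f ^ (d + q * d)) x         ≡⟨ ^-+ d (q * d) x ⟩
    (f ^ d) ((f ^ (q * d)) x)   ≡⟨ cong (f ^ d) (^-*-fixed q fᵈx≡x) ⟩
    (f ^ d) x                   ≡⟨ fᵈx≡x ⟩
    x                           ∎
    where open ≡-Reasoning

  period : ∀ x → ∃[ p ] p < n × (f ^ suc p) x ≡ x
  period x with pigeonhole (n<1+n n) (λ (k : Fin (suc n)) → (f ^ toℕ k) x)
  ... | i , j , i<j , fⁱx≡fʲx with m≤n⇒∃[o]m+o≡n i<j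
  ...   | p , 1+i+p≡j = p , p<n , sym (^-injective (toℕ i) fⁱx≡fⁱ⁺ᵖ⁺¹x)
    where
      p<n : p < n
      p<n = <-≤-trans (subst (p <_) 1+i+p≡j (s≤s (m≤n+m p (toℕ i)))) (≤-pred (toℕ<n j))
      fⁱx≡fⁱ⁺ᵖ⁺¹x : (f ^ toℕ i) x ≡ (f ^ toℕ i) ((f ^ suc p) x)
      fⁱx≡fⁱ⁺ᵖ⁺¹x = begin
        (f ^ toℕ i) x                 ≡⟨ fⁱx≡fʲx ⟩
        (f ^ toℕ j) x                 ≡⟨ cong (λ k → (f ^ k) x) (trans (sym 1+i+p≡j) (sym (+-suc (toℕ i) p))) ⟩
        (f ^ (toℕ i + suc p)) x       ≡⟨ ^-+ (toℕ i) (suc p) x ⟩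
        (f ^ toℕ i) ((f ^ suc p) x)   ∎
        where open ≡-Reasoning

  ^-reduce : ∀ k x → ∃[ k′ ] k′ < n × (f ^ k) x ≡ (f ^ k′) x
  ^-reduce k x with period x
  ... | p , p<n , fᵖ⁺¹x≡x = k % suc p , <-≤-trans (m%n<n k (suc p)) p<n , (begin
    (f ^ k) x                                            ≡⟨ cong (λ t → (f ^ t) x) (m≡m%n+[m/n]*n k (suc p)) ⟩
    (f ^ (k % suc p + k / suc p * suc p)) x              ≡⟨ ^-+ (k % suc p) (k / suc p * suc p) x ⟩
    (f ^ (k % suc p)) ((f ^ (k / suc p * suc p)) x)      ≡⟨ cong (f ^ (k % suc p)) (^-*-fixed (k / suc p) fᵖ⁺¹x≡x) ⟩
    (f ^ (k % suc p)) x                                  ∎)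
    where open ≡-Reasoning

  orbitMin : Fin n → ℕ
  orbitMin x = minUpTo (λ k → toℕ ((f ^ k) x)) n

  orbitMin-≤ : ∀ k x → orbitMin x ≤ toℕ ((f ^ k) x)
  orbitMin-≤ k x with ^-reduce k x
  ... | k′ , k′<n , fᵏx≡fᵏ′x =
    subst (λ y → orbitMin x ≤ toℕ y) (sym fᵏx≡fᵏ′x) (minUpTo-≤ _ (<⇒≤ k′<n))

  orbitMin-attained : ∀ x → ∃[ k ] orbitMin x ≡ toℕ ((f ^ k) x)
  orbitMin-attained x = minUpTo-attained _ n

  orbitMin-f : ∀ x → orbitMin (f x) ≡ orbitMin x
  orbitMin-f x = ≤-antisym orbitMin[fx]≤orbitMin[x] orbitMin[x]≤orbitMin[fx]
    where
      orbitMin[fx]≤orbitMin[x] : orbitMin (f x) ≤ orbitMin x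
      orbitMin[fx]≤orbitMin[x] with orbitMin-attained x | period x
      ... | k , eq | p , _ , fᵖ⁺¹x≡x = begin
        orbitMin (f x)                 ≤⟨ orbitMin-≤ (k + p) (f x) ⟩
        toℕ ((f ^ (k + p)) (f x))      ≡⟨ cong toℕ (^-+ k p (f x)) ⟩
        toℕ ((f ^ k) ((f ^ p) (f x)))  ≡⟨ cong (λ y → toℕ ((f ^ k) y)) (trans (^-comm p x) fᵖ⁺¹x≡x) ⟩
        toℕ ((f ^ k) x)                ≡⟨ sym eq ⟩
        orbitMin x                     ∎
        where open ≤-Reasoning
      orbitMin[x]≤orbitMin[fx] : orbitMin x ≤ orbitMin (f x)
      orbitMin[x]≤orbitMin[fx] with orbitMin-attained (f x)
      ... | k , eq = subst (orbitMin x ≤_)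
        (sym (trans eq (cong toℕ (^-comm k x)))) (orbitMin-≤ (suc k) x)

does-<?-swap : ∀ {m n} → m ≢ n → does (n <? m) ≡ not (does (m <? n))
does-<?-swap {m} {n} m≢n = swap (m <? n) (n <? m)
  where
    swap : (m<?n : Dec (m < n)) (n<?m : Dec (n < m)) → does n<?m ≡ not (does m<?n)
    swap (yes m<n) (yes n<m) = contradiction n<m (<-asym m<n)
    swap (yes _)   (no  _)   = refl
    swap (no  _)   (yes _)   = refl
    swap (no  m≮n) (no  n≮m) = contradiction (≤-antisym (≮⇒≥ n≮m) (≮⇒≥ m≮n)) m≢n

module Bipartite {n : ℕ} (α β : Fin n → Fin n)
  (α-involutive : Involutive _≡_ α) (β-involutive : Involutive _≡_ β)
  (α-fixedPointFree : ∀ x → α x ≢ x) (β-fixedPointFree : ∀ x → β x ≢ x) where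

  open Endo (Fin n) using (_^_)

  α-injective : Injective _≡_ _≡_ α
  α-injective = involutive⇒injective α-involutive

  ρ : Fin n → Fin n
  ρ = α ∘ β

  ρ-injective : Injective _≡_ _≡_ ρ
  ρ-injective = involutive⇒injective β-involutive ∘ α-injective

  open Orbits ρ ρ-injective

  ρ∘α∘ρ : ∀ x → ρ (α (ρ x)) ≡ α x
  ρ∘α∘ρ x = cong α (trans (cong β (α-involutive (β x))) (β-involutive x))

  -- Conjugating by α inverts ρ, so α x = ρᵏ⁺² x gives α (ρ x) = ρᵏ (ρ x).
  α-notInOrbit : ∀ k x → α x ≢ (ρ ^ k) x
  α-notInOrbit zero                x = α-fixedPointFree x
  α-notInOrbit (suc zero)          x αx≡ρx = β-fixedPointFree x (sym (α-injective αx≡ρx))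
  α-notInOrbit (suc (suc k))       x αx≡ρᵏ⁺²x = α-notInOrbit k (ρ x) (ρ-injective (begin
    ρ (α (ρ x))            ≡⟨ ρ∘α∘ρ x ⟩
    α x                    ≡⟨ αx≡ρᵏ⁺²x ⟩
    ρ (ρ ((ρ ^ k) x))      ≡⟨ cong ρ (sym (^-comm k x)) ⟩
    ρ ((ρ ^ k) (ρ x))      ∎))
    where open ≡-Reasoning

  α-orbits-disjoint : ∀ a b x → (ρ ^ a) (α x) ≢ (ρ ^ b) x
  α-orbits-disjoint zero    b       x = α-notInOrbit b x
  α-orbits-disjoint (suc a) zero    x eq = α-notInOrbit (suc a) (α x) (trans (α-involutive x) (sym eq))
  α-orbits-disjoint (suc a) (suc b) x eq = α-orbits-disjoint a b x (ρ-injective eq)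

  orbitMin-α : ∀ x → orbitMin (α x) ≢ orbitMin x
  orbitMin-α x eq with orbitMin-attained (α x) | orbitMin-attained x
  ... | a , eqa | b , eqb = α-orbits-disjoint a b x (toℕ-injective (trans (sym eqa) (trans eq eqb)))

  colour : Fin n → Bool
  colour x = does (orbitMin x <? orbitMin (α x))

  colour-α : ∀ x → colour (α x) ≡ not (colour x)
  colour-α x = trans (cong (λ y → does (orbitMin (α x) <? orbitMin y)) (α-involutive x))
                     (does-<?-swap (orbitMin-α x ∘ sym))

  colour-ρ : ∀ x → colour (ρ x) ≡ colour x
  colour-ρ x = cong₂ (λ a b → does (a <? b)) (orbitMin-f x)
                     (trans (sym (orbitMin-f (α (ρ x)))) (cong orbitMin (ρ∘α∘ρ x)))

  colour-β : ∀ x → colour (β x) ≡ not (colour x)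
  colour-β x = begin
    colour (β x)          ≡⟨ cong colour (sym (α-involutive (β x))) ⟩
    colour (α (ρ x))      ≡⟨ colour-α (ρ x) ⟩
    not (colour (ρ x))    ≡⟨ cong not (colour-ρ x) ⟩
    not (colour x)        ∎
    where open ≡-Reasoning

opposite-fixedPointFree : ∀ {n} → 2 ∣ n → (x : Fin n) → opposite x ≢ x
opposite-fixedPointFree {n} (divides q n≡q*2) x opposite[x]≡x = even≢odd q t (begin
  2 * q                 ≡⟨ *-comm 2 q ⟩
  q * 2                 ≡⟨ sym n≡q*2 ⟩
  n                     ≡⟨ sym (m+[n∸m]≡n (toℕ<n x)) ⟩
  suc t + (n ∸ suc t)   ≡⟨ cong (suc t +_) n∸1+t≡t ⟩
  suc (t + t)           ≡⟨ cong (λ u → suc (t + u)) (sym (+-identityʳ t)) ⟩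
  suc (2 * t)           ∎)
  where
    open ≡-Reasoning
    t = toℕ x
    n∸1+t≡t : n ∸ suc t ≡ t
    n∸1+t≡t = trans (sym (opposite-prop x)) (cong toℕ opposite[x]≡x)

module _ {n : ℕ} where

  δ : Fin n → Fin n → ℕ
  δ i j = if does (i ≟ j) then 1 else 0

  δ-0∨1 : ∀ i j → δ i j ≡ 0 ⊎ δ i j ≡ 1
  δ-0∨1 i j with i ≟ j
  ... | yes _ = inj₂ refl
  ... | no  _ = inj₁ refl

  δ-refl : ∀ i → δ i i ≡ 1
  δ-refl i with i ≟ i
  ... | yes _   = refl
  ... | no  i≢i = contradiction refl i≢i

  δ≡1⇒≡ : ∀ {i j} → δ i j ≡ 1 → i ≡ j
  δ≡1⇒≡ {i} {j} δij≡1 with i ≟ j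
  ... | yes i≡j = i≡j

  δ-injective : ∀ {g : Fin n → Fin n} → Injective _≡_ _≡_ g → ∀ i j → δ (g i) (g j) ≡ δ i j
  δ-injective {g} g-injective i j with g i ≟ g j | i ≟ j
  ... | yes _       | yes _   = refl
  ... | no  _       | no  _   = refl
  ... | yes gi≡gj   | no  i≢j = contradiction (g-injective gi≡gj) i≢j
  ... | no  gi≢gj   | yes i≡j = contradiction (cong g i≡j) gi≢gj

  permutationMatrix : Permutation′ n → Matrix n
  permutationMatrix σ i j = δ (σ ⟨$⟩ʳ i) j

  permutationMatrix-isPermutationMatrix : ∀ σ → IsPermutationMatrix (permutationMatrix σ)
  permutationMatrix-isPermutationMatrix σ =
    (λ i j → δ-0∨1 (σ ⟨$⟩ʳ i) j) ,
    (λ i → σ ⟨$⟩ʳ i , δ-refl (σ ⟨$⟩ʳ i) , λ j δ≡1 → sym (δ≡1⇒≡ δ≡1)) ,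
    (λ j → σ ⟨$⟩ˡ j , subst (λ k → δ k j ≡ 1) (sym (inverseʳ σ)) (δ-refl j) ,
           λ i δ≡1 → trans (sym (inverseˡ σ)) (cong (σ ⟨$⟩ˡ_) (δ≡1⇒≡ δ≡1)))

  isPermutationMatrix⇒permutationMatrix : ∀ {P} → IsPermutationMatrix P →
    ∃[ σ ] (∀ i j → P i j ≡ permutationMatrix σ i j)
  isPermutationMatrix⇒permutationMatrix {P} (entries , rows , columns) = σ , P≡δ
    where
      σ : Permutation′ n
      σ = permutation (proj₁ ∘ rows) (proj₁ ∘ columns)
        (λ j → let (i , Pij≡1 , _) = columns j in sym (proj₂ (proj₂ (rows i)) j Pij≡1))
        (λ i → let (j , Pij≡1 , _) = rows i in sym (proj₂ (proj₂ (columns j)) i Pij≡1))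
      P≡δ : ∀ i j → P i j ≡ δ (σ ⟨$⟩ʳ i) j
      P≡δ i j with rows i | σ ⟨$⟩ʳ i ≟ j
      ... | _ , Pij≡1 , _      | yes refl = Pij≡1
      ... | _ , _ , unique     | no σi≢j with entries i j
      ...   | inj₁ Pij≡0 = Pij≡0
      ...   | inj₂ Pij≡1 = contradiction (sym (unique j Pij≡1)) σi≢j

  rotate : Permutation′ n → Permutation′ n
  rotate σ = reverse ∘ₚ σ ∘ₚ reverse

  permutationMatrix-^π : ∀ σ i j → (permutationMatrix σ ^π) i j ≡ permutationMatrix (rotate σ) i j
  permutationMatrix-^π σ i j = begin
    δ (σ ⟨$⟩ʳ opposite i) (opposite j)                          ≡⟨ cong (λ k → δ k (opposite j)) (sym (opposite-involutive _)) ⟩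
    δ (opposite (opposite (σ ⟨$⟩ʳ opposite i))) (opposite j)    ≡⟨ δ-injective {opposite} (involutive⇒injective opposite-involutive) _ j ⟩
    δ (opposite (σ ⟨$⟩ʳ opposite i)) j                          ∎
    where open ≡-Reasoning

  rotate-invariant⇒centrosymmetric : ∀ σ → rotate σ ≈ σ → IsCentrosymmetric (permutationMatrix σ)
  rotate-invariant⇒centrosymmetric σ rotate[σ]≈σ i j =
    trans (permutationMatrix-^π σ i j) (cong (λ k → δ k j) (rotate[σ]≈σ i))

  -- Invariance of c along τ⁻¹ ∘ σ keeps the σ-rows and the τ-rows of the splice from colliding.
  splice : (c : Fin n → Bool) (σ τ : Permutation′ n) →
    (∀ i → c (τ ⟨$⟩ˡ (σ ⟨$⟩ʳ i)) ≡ c i) → Permutation′ n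
  splice c σ τ c-invariant = permutation to from to∘from from∘to
    where
      to : Fin n → Fin n
      to i = if c i then σ ⟨$⟩ʳ i else τ ⟨$⟩ʳ i
      from : Fin n → Fin n
      from j = if c (σ ⟨$⟩ˡ j) then σ ⟨$⟩ˡ j else τ ⟨$⟩ˡ j
      c∘τ⁻¹≗c∘σ⁻¹ : ∀ j → c (τ ⟨$⟩ˡ j) ≡ c (σ ⟨$⟩ˡ j)
      c∘τ⁻¹≗c∘σ⁻¹ j = trans (cong (λ k → c (τ ⟨$⟩ˡ k)) (sym (inverseʳ σ))) (c-invariant (σ ⟨$⟩ˡ j))
      to∘from : ∀ j → to (from j) ≡ j
      to∘from j with c (σ ⟨$⟩ˡ j) in eq
      ... | true  = trans (if-cong eq) (inverseʳ σ)
      ... | false = trans (if-cong (trans (c∘τ⁻¹≗c∘σ⁻¹ j) eq)) (inverseʳ τ)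
      from∘to : ∀ i → from (to i) ≡ i
      from∘to i with c i in eq
      ... | true  = trans (if-cong (trans (cong c (inverseˡ σ)) eq)) (inverseˡ σ)
      ... | false = trans (if-cong (trans (sym (c∘τ⁻¹≗c∘σ⁻¹ (τ ⟨$⟩ʳ i))) (trans (cong c (inverseˡ τ)) eq)))
                          (inverseˡ τ)

  splice-⊕ : ∀ c σ τ c-invariant i j →
    permutationMatrix σ i j + permutationMatrix τ i j ≡
    permutationMatrix (splice c σ τ c-invariant) i j +
    permutationMatrix (splice (not ∘ c) σ τ (cong not ∘ c-invariant)) i j
  splice-⊕ c σ τ _ i j with c i
  ... | true  = refl
  ... | false = +-comm (permutationMatrix σ i j) (permutationMatrix τ i j)

  rotate-splice : ∀ c σ c-invariant → (∀ i → c (opposite i) ≡ not (c i)) →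
    rotate (splice c σ (rotate σ) c-invariant) ≈ splice c σ (rotate σ) c-invariant
  rotate-splice c σ _ c∘opposite i with c i in eq
  ... | true  = trans (cong opposite (if-cong (trans (c∘opposite i) (cong not eq))))
                      (trans (opposite-involutive _) (cong (σ ⟨$⟩ʳ_) (opposite-involutive i)))
  ... | false = cong opposite (if-cong (trans (c∘opposite i) (cong not eq)))

centrosymmetricSplitting : ∀ {n} → 2 ∣ n → (σ : Permutation′ n) →
  ∃₂ λ τ₁ τ₂ → rotate τ₁ ≈ τ₁ × rotate τ₂ ≈ τ₂ ×
    (∀ i j → permutationMatrix σ i j + permutationMatrix (rotate σ) i j ≡
             permutationMatrix τ₁ i j + permutationMatrix τ₂ i j)
centrosymmetricSplitting {n} 2∣n σ =
  splice c σ (rotate σ) c-invariant , splice (not ∘ c) σ (rotate σ) (cong not ∘ c-invariant) ,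
  rotate-splice c σ c-invariant c∘opposite ,
  rotate-splice (not ∘ c) σ (cong not ∘ c-invariant) (cong not ∘ c∘opposite) ,
  splice-⊕ c σ (rotate σ) c-invariant
  where
    β : Fin n → Fin n
    β i = σ ⟨$⟩ˡ opposite (σ ⟨$⟩ʳ i)
    β-involutive : Involutive _≡_ β
    β-involutive i = begin
      σ ⟨$⟩ˡ opposite (σ ⟨$⟩ʳ (σ ⟨$⟩ˡ opposite (σ ⟨$⟩ʳ i)))   ≡⟨ cong (λ k → σ ⟨$⟩ˡ opposite k) (inverseʳ σ) ⟩
      σ ⟨$⟩ˡ opposite (opposite (σ ⟨$⟩ʳ i))                 ≡⟨ cong (σ ⟨$⟩ˡ_) (opposite-involutive _) ⟩
      σ ⟨$⟩ˡ (σ ⟨$⟩ʳ i)                                     ≡⟨ inverseˡ σ ⟩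
      i                                                     ∎
      where open ≡-Reasoning
    β-fixedPointFree : ∀ i → β i ≢ i
    β-fixedPointFree i βi≡i =
      opposite-fixedPointFree 2∣n (σ ⟨$⟩ʳ i) (trans (sym (inverseʳ σ)) (cong (σ ⟨$⟩ʳ_) βi≡i))
    open Bipartite opposite β opposite-involutive β-involutive
                   (opposite-fixedPointFree 2∣n) β-fixedPointFree
      using () renaming (colour to c; colour-α to c∘opposite; colour-β to c∘β)
    c-invariant : ∀ i → c (rotate σ ⟨$⟩ˡ (σ ⟨$⟩ʳ i)) ≡ c i
    c-invariant i = trans (c∘opposite (β i)) (trans (cong not (c∘β i)) (not-involutive (c i)))

lemma3p8 : (n : ℕ) → 2 ∣ n → (P : Matrix n) → IsPermutationMatrix P →
    Σ (Matrix n) λ Q₁ → Σ (Matrix n) λ Q₂ →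
      (IsPermutationMatrix Q₁ × IsCentrosymmetric Q₁) ×
      (IsPermutationMatrix Q₂ × IsCentrosymmetric Q₂) ×
      ((i j : Fin n) → (P ⊕ (P ^π)) i j ≡ (Q₁ ⊕ Q₂) i j)
lemma3p8 n 2∣n P P-isPermutationMatrix =
  let σ , P≡σ = isPermutationMatrix⇒permutationMatrix P-isPermutationMatrix
      τ₁ , τ₂ , τ₁-centrosymmetric , τ₂-centrosymmetric , split = centrosymmetricSplitting 2∣n σ
  in permutationMatrix τ₁ , permutationMatrix τ₂ ,
     (permutationMatrix-isPermutationMatrix τ₁ , rotate-invariant⇒centrosymmetric τ₁ τ₁-centrosymmetric) ,
     (permutationMatrix-isPermutationMatrix τ₂ , rotate-invariant⇒centrosymmetric τ₂ τ₂-centrosymmetric) ,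
     λ i j → trans (cong₂ _+_ (P≡σ i j) (trans (P≡σ (opposite i) (opposite j)) (permutationMatrix-^π σ i j)))
                   (split i j)
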